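{- Let $k$ be a positive integer and let $D$ be a digraph of order $n$ with no isolated vertex whose maximum in-degree $\Delta^-$ and maximum out-degree $\Delta^+$ satisfy $\Delta^-\ge\Delta^+\ge1$. If $k>(\Delta^-)^2$, then $\gamma_{trk}(D)=n$.
   Context: All digraphs are finite, without loops or multiple arcs (pairs of opposite arcs are allowed). $N^-(v)$ is the set of in-neighbors of $v$. A vertex is isolated if it has no in- or out-neighbors. A $k$RDF on $D$ is a function $f:V(D)\to\mathcal{P}(\{1,\dots,k\})$ such that every $v$ with $f(v)=\emptyset$ satisfies $\bigcup_{u\in N^-(v)}f(u)=\{1,\dots,k\}$; its weight is $\sum_v|f(v)|$. For $D$ with no isolated vertex, a T$k$RDF is a $k$RDF $f$ such that the subdigraph induced by $\{v:f(v)\neq\emptyset\}$ has no isolated vertex; $\gamma_{trk}(D)$ is the minimum weight of a T$k$RDF. -}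

module Defs where

open import Data.Nat using (ℕ; _≤_; _⊔_; zero; suc)
open import Data.Fin using (Fin)
open import Data.Fin.Subset using (Subset; ∣_∣; _∈_; Empty; Nonempty)
open import Data.Vec using (Vec; tabulate; foldr)
open import Data.Bool using (Bool; true)
open import Data.Product using (Σ; ∃; _×_; _,_)
open import Data.Sum using (_⊎_)
open import Relation.Binary.PropositionalEquality using (_≡_)
open import Relation.Nullary using (¬_)

-- A digraph on vertex set Fin n: arc relation given as a Boolean
-- adjacency function (adj u v ≡ true means there is an arc u → v).
-- No loops; multiple arcs are impossible by construction; opposite
-- arcs are allowed.
record Digraph (n : ℕ) : Set where
  field
    adj   : Fin n → Fin n → Bool
    loopless : ∀ v → ¬ (adj v v ≡ true)
open Digraph public

Arc : ∀ {n} → Digraph n → Fin n → Fin n → Set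
Arc D u v = adj D u v ≡ true

inNbhd : ∀ {n} → Digraph n → Fin n → Subset n
inNbhd D v = tabulate (λ u → adj D u v)

outNbhd : ∀ {n} → Digraph n → Fin n → Subset n
outNbhd D v = tabulate (λ w → adj D v w)

inDeg outDeg : ∀ {n} → Digraph n → Fin n → ℕ
inDeg D v = ∣ inNbhd D v ∣
outDeg D v = ∣ outNbhd D v ∣

-- maximum of a function over Fin n (0 when n = 0)
maxOver : ∀ {n} → (Fin n → ℕ) → ℕ
maxOver g = foldr _ _⊔_ 0 (tabulate g)

maxInDeg maxOutDeg : ∀ {n} → Digraph n → ℕ
maxInDeg D = maxOver (inDeg D)
maxOutDeg D = maxOver (outDeg D)

Isolated : ∀ {n} → Digraph n → Fin n → Set
Isolated D v = (∀ u → ¬ Arc D u v) × (∀ w → ¬ Arc D v w)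

NoIsolated : ∀ {n} → Digraph n → Set
NoIsolated D = ∀ v → ¬ Isolated D v

-- Labels {1,…,k} are represented by Fin k; f(v) ⊆ {1..k} by Subset k.
Labelling : ℕ → ℕ → Set
Labelling n k = Fin n → Subset k

IsKRDF : ∀ {n} → Digraph n → (k : ℕ) → Labelling n k → Set
IsKRDF {n} D k f =
  ∀ v → Empty (f v) → ∀ (i : Fin k) → ∃ λ u → Arc D u v × i ∈ f u

-- Total: the subdigraph induced by {v : f v ≠ ∅} has no isolated vertex.
IsTkRDF : ∀ {n} → Digraph n → (k : ℕ) → Labelling n k → Set
IsTkRDF {n} D k f =
  IsKRDF D k f ×
  (∀ v → Nonempty (f v) →
     ∃ λ u → Nonempty (f u) × (Arc D u v ⊎ Arc D v u))

sumOver : ∀ {n} → (Fin n → ℕ) → ℕ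
sumOver g = foldr _ Data.Nat._+_ 0 (tabulate g)

weight : ∀ {n k} → Labelling n k → ℕ
weight f = sumOver (λ v → ∣ f v ∣)

γtrk≡ : ∀ {n} → Digraph n → (k : ℕ) → ℕ → Set
γtrk≡ {n} D k m =
  (Σ (Labelling n k) λ f → IsTkRDF D k f × weight f ≡ m) ×
  (∀ (f : Labelling n k) → IsTkRDF D k f → m ≤ weight f)

module Submission where

-- Every vertex with an empty label must see all k labels on its at most Δ⁻ in-neighbours, so
-- since k > (Δ⁻)² one of them carries more than Δ⁻ ≥ Δ⁺ labels.  Let every vertex with a
-- nonempty label pay 1 for itself, and every such heavy vertex pay 1 for each of its at most
-- Δ⁺ out-neighbours: each vertex is paid for, and no vertex pays more than its label size,
-- so every kRDF has weight at least n.  A constant singleton labelling attains n.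

open import Defs
open import Data.Nat using (ℕ; zero; suc; _+_; _*_; _≤_; _<_; _⊓_; z≤n; s≤s; _<?_)
open import Data.Nat.Properties
open import Data.Fin as Fin using (Fin)
open import Data.Fin.Properties using (any?)
open import Data.Fin.Subset using (Subset; ∣_∣; _∈_; Empty; Nonempty; ⁅_⁆)
open import Data.Fin.Subset.Properties using (x∈⁅x⁆; ∣⁅x⁆∣≡1; x∈p⇒∣p-x∣<∣p∣)
open import Data.Vec using ([]; _∷_; tabulate; lookup)
open import Data.Vec.Properties using ([]=⇒lookup; lookup∘tabulate)
open import Data.Bool using (Bool; true; false) renaming (_≟_ to _≟ᵇ_)
open import Data.Product using (∃; _×_; _,_; map₂)
open import Data.Sum using (_⊎_; inj₁; inj₂)
open import Function using (_∘_)
open import Relation.Nullary using (yes; no; contradiction)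
open import Relation.Nullary.Decidable using (_×-dec_; _⊎-dec_)
open import Relation.Binary.PropositionalEquality
open import Algebra.Properties.Semiring.Sum +-*-semiring
  using (sum-syntax; sum-cong-≗; ∑-distrib-+; ∑-comm; *-distribˡ-sum)

toℕ : Bool → ℕ
toℕ true = 1
toℕ false = 0

sumOver≡∑ : ∀ {n} (g : Fin n → ℕ) → sumOver g ≡ ∑[ i < n ] g i
sumOver≡∑ {zero} g = refl
sumOver≡∑ {suc n} g = cong (g Fin.zero +_) (sumOver≡∑ (g ∘ Fin.suc))

∑-const : ∀ n c → ∑[ i < n ] c ≡ n * c
∑-const zero c = refl
∑-const (suc n) c = cong (c +_) (∑-const n c)

∑-mono-≤ : ∀ {n} {g h : Fin n → ℕ} → (∀ i → g i ≤ h i) → ∑[ i < n ] g i ≤ ∑[ i < n ] h i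
∑-mono-≤ {zero} _ = z≤n
∑-mono-≤ {suc n} g≤h = +-mono-≤ (g≤h Fin.zero) (∑-mono-≤ (g≤h ∘ Fin.suc))

term≤∑ : ∀ {n} (g : Fin n → ℕ) i → g i ≤ ∑[ j < n ] g j
term≤∑ g Fin.zero = m≤m+n _ _
term≤∑ g (Fin.suc i) = ≤-trans (term≤∑ (g ∘ Fin.suc) i) (m≤n+m _ (g Fin.zero))

term≤maxOver : ∀ {n} (g : Fin n → ℕ) i → g i ≤ maxOver g
term≤maxOver g Fin.zero = m≤m⊔n _ _
term≤maxOver g (Fin.suc i) = ≤-trans (term≤maxOver (g ∘ Fin.suc) i) (m≤n⊔m (g Fin.zero) _)

∣p∣≡∑lookup : ∀ {n} (p : Subset n) → ∣ p ∣ ≡ ∑[ i < n ] toℕ (lookup p i)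
∣p∣≡∑lookup [] = refl
∣p∣≡∑lookup (true ∷ p) = cong suc (∣p∣≡∑lookup p)
∣p∣≡∑lookup (false ∷ p) = ∣p∣≡∑lookup p

∣tabulate∣≡∑ : ∀ {n} (g : Fin n → Bool) → ∣ tabulate g ∣ ≡ ∑[ i < n ] toℕ (g i)
∣tabulate∣≡∑ g = trans (∣p∣≡∑lookup (tabulate g)) (sum-cong-≗ (cong toℕ ∘ lookup∘tabulate g))

∣p∣≡0⇒Empty : ∀ {n} {p : Subset n} → ∣ p ∣ ≡ 0 → Empty p
∣p∣≡0⇒Empty ∣p∣≡0 (x , x∈p) = <⇒≢ (≤-<-trans z≤n (x∈p⇒∣p-x∣<∣p∣ x∈p)) (sym ∣p∣≡0)

hasNeighbour : ∀ {n} (D : Digraph n) → NoIsolated D → ∀ v → ∃ λ u → Arc D u v ⊎ Arc D v u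
hasNeighbour D noIsolated v with any? (λ u → (adj D u v ≟ᵇ true) ⊎-dec (adj D v u ≟ᵇ true))
... | yes neighbour = neighbour
... | no ¬neighbour = contradiction
  ((λ u uv → ¬neighbour (u , inj₁ uv)) , (λ w vw → ¬neighbour (w , inj₂ vw))) (noIsolated v)

constant-isTkRDF : ∀ {n k} (D : Digraph n) {p : Subset k} → NoIsolated D → Nonempty p →
  IsTkRDF D k (λ _ → p)
constant-isTkRDF D noIsolated p≠∅ =
  (λ _ p≡∅ → contradiction p≠∅ p≡∅) , λ v _ → map₂ (p≠∅ ,_) (hasNeighbour D noIsolated v)

weight-const : ∀ {n k} (p : Subset k) → weight {n} (λ _ → p) ≡ n * ∣ p ∣
weight-const {n} p = trans (sumOver≡∑ {n} (λ _ → ∣ p ∣)) (∑-const n ∣ p ∣)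

module _ {n k} (D : Digraph n) (f : Labelling n k) where

  Covered : Fin n → Set
  Covered v = ∀ i → ∃ λ u → Arc D u v × i ∈ f u

  covered⇒k≤∑ : ∀ {v} → Covered v → k ≤ ∑[ u < n ] (toℕ (adj D u v) * ∣ f u ∣)
  covered⇒k≤∑ {v} covered = begin
    k
      ≡⟨ sym (trans (∑-const k 1) (*-identityʳ k)) ⟩
    ∑[ i < k ] 1
      ≤⟨ ∑-mono-≤ hit ⟩
    ∑[ i < k ] ∑[ u < n ] (toℕ (adj D u v) * toℕ (lookup (f u) i))
      ≡⟨ ∑-comm (λ i u → toℕ (adj D u v) * toℕ (lookup (f u) i)) ⟩
    ∑[ u < n ] ∑[ i < k ] (toℕ (adj D u v) * toℕ (lookup (f u) i))
      ≡⟨ sum-cong-≗ factor ⟩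
    ∑[ u < n ] (toℕ (adj D u v) * ∣ f u ∣) ∎
    where
    open ≤-Reasoning
    hit : ∀ i → 1 ≤ ∑[ u < n ] (toℕ (adj D u v) * toℕ (lookup (f u) i))
    hit i with covered i
    ... | u , uv , i∈fu = ≤-trans
      (≤-reflexive (cong₂ (λ a b → toℕ a * toℕ b) (sym uv) (sym ([]=⇒lookup i∈fu))))
      (term≤∑ (λ u → toℕ (adj D u v) * toℕ (lookup (f u) i)) u)
    factor : ∀ u →
      ∑[ i < k ] (toℕ (adj D u v) * toℕ (lookup (f u) i)) ≡ toℕ (adj D u v) * ∣ f u ∣
    factor u = trans (sym (*-distribˡ-sum (toℕ (adj D u v)) (λ i → toℕ (lookup (f u) i))))
                     (cong (toℕ (adj D u v) *_) (sym (∣p∣≡∑lookup (f u))))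

  ∑-inNeighbours≤ : ∀ {v c} → (∀ u → Arc D u v → ∣ f u ∣ ≤ c) →
    ∑[ u < n ] (toℕ (adj D u v) * ∣ f u ∣) ≤ inDeg D v * c
  ∑-inNeighbours≤ {v} {c} bounded = begin
    ∑[ u < n ] (toℕ (adj D u v) * ∣ f u ∣) ≤⟨ ∑-mono-≤ termwise ⟩
    ∑[ u < n ] (toℕ (adj D u v) * c)       ≡⟨ sum-cong-≗ (λ u → *-comm (toℕ (adj D u v)) c) ⟩
    ∑[ u < n ] (c * toℕ (adj D u v))       ≡⟨ sym (*-distribˡ-sum c (λ u → toℕ (adj D u v))) ⟩
    c * ∑[ u < n ] toℕ (adj D u v)         ≡⟨ cong (c *_) (sym (∣tabulate∣≡∑ (λ u → adj D u v))) ⟩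
    c * inDeg D v                          ≡⟨ *-comm c _ ⟩
    inDeg D v * c                          ∎
    where
    open ≤-Reasoning
    termwise : ∀ u → toℕ (adj D u v) * ∣ f u ∣ ≤ toℕ (adj D u v) * c
    termwise u with adj D u v in uv
    ... | true = +-monoˡ-≤ 0 (bounded u uv)
    ... | false = z≤n

  covered⇒heavyInNeighbour : ∀ {v Δ} → inDeg D v ≤ Δ → Δ * Δ < k → Covered v →
    ∃ λ u → Arc D u v × Δ < ∣ f u ∣
  covered⇒heavyInNeighbour {v} {Δ} inDeg≤Δ Δ²<k covered
    with any? (λ u → (adj D u v ≟ᵇ true) ×-dec (Δ <? ∣ f u ∣))
  ... | yes found = found
  ... | no ¬found = contradiction Δ²<k (≤⇒≯ (begin
    k                                      ≤⟨ covered⇒k≤∑ covered ⟩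
    ∑[ u < n ] (toℕ (adj D u v) * ∣ f u ∣) ≤⟨ ∑-inNeighbours≤ light ⟩
    inDeg D v * Δ                          ≤⟨ *-monoˡ-≤ Δ inDeg≤Δ ⟩
    Δ * Δ                                  ∎))
    where
    open ≤-Reasoning
    light : ∀ u → Arc D u v → ∣ f u ∣ ≤ Δ
    light u uv = ≮⇒≥ (λ Δ<fu → ¬found (u , uv , Δ<fu))

heavy : ℕ → ℕ → ℕ
heavy Δ w with Δ <? w
... | yes _ = 1
... | no _ = 0

heavy≡1 : ∀ {Δ w} → Δ < w → heavy Δ w ≡ 1
heavy≡1 {Δ} {w} Δ<w with Δ <? w
... | yes _ = refl
... | no Δ≮w = contradiction Δ<w Δ≮w

charge≤ : ∀ Δ w {d} → d ≤ Δ → 1 ⊓ w + heavy Δ w * d ≤ w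
charge≤ Δ w d≤Δ with Δ <? w
charge≤ Δ (suc w) {d} d≤Δ | yes (s≤s Δ≤w) =
  s≤s (≤-trans (≤-reflexive (+-identityʳ d)) (≤-trans d≤Δ Δ≤w))
charge≤ Δ zero d≤Δ | no _ = z≤n
charge≤ Δ (suc w) d≤Δ | no _ = s≤s z≤n

kRDF-weight≥order : ∀ {n k Δ} (D : Digraph n) (f : Labelling n k) →
  (∀ v → inDeg D v ≤ Δ) → (∀ v → outDeg D v ≤ Δ) → Δ * Δ < k →
  IsKRDF D k f → n ≤ weight f
kRDF-weight≥order {n} {k} {Δ} D f inDeg≤Δ outDeg≤Δ Δ²<k isKRDF = begin
  n
    ≡⟨ sym (trans (∑-const n 1) (*-identityʳ n)) ⟩
  ∑[ v < n ] 1
    ≤⟨ ∑-mono-≤ charged ⟩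
  ∑[ v < n ] (1 ⊓ w v + ∑[ u < n ] (h u * toℕ (adj D u v)))
    ≡⟨ ∑-distrib-+ (λ v → 1 ⊓ w v) (λ v → ∑[ u < n ] (h u * toℕ (adj D u v))) ⟩
  ∑[ v < n ] (1 ⊓ w v) + ∑[ v < n ] ∑[ u < n ] (h u * toℕ (adj D u v))
    ≡⟨ cong (∑[ v < n ] (1 ⊓ w v) +_) (∑-comm (λ v u → h u * toℕ (adj D u v))) ⟩
  ∑[ v < n ] (1 ⊓ w v) + ∑[ u < n ] ∑[ v < n ] (h u * toℕ (adj D u v))
    ≡⟨ cong (∑[ v < n ] (1 ⊓ w v) +_) (sum-cong-≗ paidOut) ⟩
  ∑[ v < n ] (1 ⊓ w v) + ∑[ u < n ] (h u * outDeg D u)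
    ≡⟨ sym (∑-distrib-+ (λ u → 1 ⊓ w u) (λ u → h u * outDeg D u)) ⟩
  ∑[ u < n ] (1 ⊓ w u + h u * outDeg D u)
    ≤⟨ ∑-mono-≤ (λ u → charge≤ Δ (w u) (outDeg≤Δ u)) ⟩
  ∑[ u < n ] w u
    ≡⟨ sumOver≡∑ w ⟨
  weight f ∎
  where
  open ≤-Reasoning
  w : Fin n → ℕ
  w u = ∣ f u ∣
  h : Fin n → ℕ
  h u = heavy Δ (w u)
  charged : ∀ v → 1 ≤ 1 ⊓ w v + ∑[ u < n ] (h u * toℕ (adj D u v))
  charged v with w v in fv
  ... | suc _ = s≤s z≤n
  ... | zero with covered⇒heavyInNeighbour D f (inDeg≤Δ v) Δ²<k (isKRDF v (∣p∣≡0⇒Empty fv))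
  ... | u , uv , Δ<fu = ≤-trans
    (≤-reflexive (sym (cong₂ (λ a b → a * toℕ b) (heavy≡1 Δ<fu) uv)))
    (term≤∑ (λ u → h u * toℕ (adj D u v)) u)
  paidOut : ∀ u → ∑[ v < n ] (h u * toℕ (adj D u v)) ≡ h u * outDeg D u
  paidOut u = trans (sym (*-distribˡ-sum (h u) (λ v → toℕ (adj D u v))))
                    (cong (h u *_) (sym (∣tabulate∣≡∑ (adj D u))))

corollary3p1 : (k n : ℕ) → 1 ≤ k → (D : Digraph n) → NoIsolated D →
    maxOutDeg D ≤ maxInDeg D → 1 ≤ maxOutDeg D →
    maxInDeg D * maxInDeg D < k →
    γtrk≡ D k n
corollary3p1 (suc k) n _ D noIsolated Δ⁺≤Δ⁻ _ Δ⁻²<k =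
  ( (λ _ → ⁅ Fin.zero ⁆)
  , constant-isTkRDF D noIsolated (Fin.zero , x∈⁅x⁆ Fin.zero)
  , trans (weight-const {n} {suc k} ⁅ Fin.zero ⁆)
          (trans (cong (n *_) (∣⁅x⁆∣≡1 {suc k} Fin.zero)) (*-identityʳ n)) )
  , λ f (isKRDF , _) → kRDF-weight≥order D f
      (term≤maxOver (inDeg D))
      (λ v → ≤-trans (term≤maxOver (outDeg D) v) Δ⁺≤Δ⁻)
      Δ⁻²<k isKRDF
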